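{- For any poset $P$ and $q>|P|$, the order of promotion on $\mathrm{Inc}^q(P)$ is divisible by $q$.
   Context: $P$ is a finite poset. $\mathrm{Inc}^q(P)$ is the set of increasing labelings $f:P\to[q]$ ($f(x)<f(y)$ whenever $x<y$). Promotion $\mathrm{Pro}$: replace labels $1$ by empty boxes; for $i=2,\dots,q$ slide boxes upward (a box at $x$ becomes $i$ if some $y\gtrdot x$ is labeled $i$, and that element becomes a box); replace boxes by $q+1$ and subtract $1$ from all labels. The order of promotion is the least $N\ge1$ with $\mathrm{Pro}^N$ the identity on $\mathrm{Inc}^q(P)$. -}

module Defs where

open import Data.Nat using (ℕ; zero; suc; _<_; _≤_; _∸_; _≡ᵇ_)
open import Data.Fin using (Fin)
open import Data.Fin.Properties using (any?) renaming (_≟_ to _≟ᶠ_)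
open import Data.Bool using (Bool; true; false; if_then_else_; _∧_)
open import Data.Maybe using (Maybe; just; nothing; maybe)
open import Data.Product using (Σ; ∃; _×_; _,_)
open import Relation.Binary.PropositionalEquality using (_≡_; _≢_)
open import Relation.Binary.Structures using (IsDecPartialOrder)
open import Relation.Nullary using (¬_; Dec; does; yes; no)
open import Relation.Nullary.Decidable using (_×-dec_; ¬?; T?)

record FinPoset : Set₁ where
  field
    n : ℕ
    _≼_ : Fin n → Fin n → Set
    isDecPartialOrder : IsDecPartialOrder _≡_ _≼_

  open IsDecPartialOrder isDecPartialOrder public using (_≤?_)

  _≺_ : Fin n → Fin n → Set
  x ≺ y = x ≼ y × x ≢ y

  _≺?_ : (x y : Fin n) → Dec (x ≺ y)
  x ≺? y = (x ≤? y) ×-dec ¬? (x ≟ᶠ y)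

  _⋖_ : Fin n → Fin n → Set
  x ⋖ y = x ≺ y × ¬ (∃ λ z → x ≺ z × z ≺ y)

  _⋖?_ : (x y : Fin n) → Dec (x ⋖ y)
  x ⋖? y = (x ≺? y) ×-dec ¬? (any? (λ z → (x ≺? z) ×-dec (z ≺? y)))

open FinPoset public

Labeling : FinPoset → Set
Labeling P = Fin (n P) → ℕ

Inc : (P : FinPoset) → ℕ → Labeling P → Set
Inc P q f = (∀ x → 1 ≤ f x × f x ≤ q) × (∀ x y → _≺_ P x y → f x < f y)

-- Intermediate labelings with empty boxes (nothing = box).
BoxLabeling : FinPoset → Set
BoxLabeling P = Fin (n P) → Maybe ℕ

isLabel : Maybe ℕ → ℕ → Bool
isLabel nothing  i = false
isLabel (just l) i = l ≡ᵇ i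

isBox : Maybe ℕ → Bool
isBox nothing  = true
isBox (just _) = false

-- One sliding step for label i (simultaneous update):
-- a box at z becomes i if some y covering z is labeled i;
-- an element z labeled i becomes a box if it covers some box.
slideStep : (P : FinPoset) → ℕ → BoxLabeling P → BoxLabeling P
slideStep P i g z with g z
... | nothing = if does (any? (λ y → _⋖?_ P z y ×-dec T? (isLabel (g y) i)))
                  then just i else nothing
... | just l  = if (l ≡ᵇ i) ∧ does (any? (λ x → _⋖?_ P x z ×-dec T? (isBox (g x))))
                  then nothing else just l

slideUpTo : (P : FinPoset) → ℕ → BoxLabeling P → BoxLabeling P
slideUpTo P zero          g = g
slideUpTo P (suc zero)    g = g
slideUpTo P (suc (suc k)) g = slideStep P (suc (suc k)) (slideUpTo P (suc k) g)

Pro : (P : FinPoset) → ℕ → Labeling P → Labeling P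
Pro P q f = λ z → maybe (λ l → l ∸ 1) q (slideUpTo P q start z)
  where
  start : BoxLabeling P
  start z = if f z ≡ᵇ 1 then nothing else just (f z)
  -- boxes become q+1, then all labels decrease by 1 (box ↦ q)

iterate : {A : Set} → (A → A) → ℕ → A → A
iterate h zero    a = a
iterate h (suc k) a = h (iterate h k a)

ProPowerIsId : (P : FinPoset) → ℕ → ℕ → Set
ProPowerIsId P q N = ∀ f → Inc P q f → ∀ x → iterate (Pro P q) N f x ≡ f x

IsPromotionOrder : (P : FinPoset) → ℕ → ℕ → Set
IsPromotionOrder P q N =
  1 ≤ N × ProPowerIsId P q N × (∀ M → 1 ≤ M → M < N → ¬ ProPowerIsId P q M)

{-# OPTIONS --safe #-}
module Submission where

-- Promotion on Inc^q(P) is the composite τ_{q-1} ∘ ⋯ ∘ τ_1 of the toggles τ_a, where τ_a swaps the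
-- labels a and a+1 at every element where the labeling stays increasing.  On increasing labelings
-- each τ_a is an involution and acts on the set of labels in use by the transposition (a a+1).
-- Hence promotion is injective on the finite set Inc^q(P), so it has an order, and it rotates the
-- labels in use: v is a label of Pro f iff v+1 (mod q) is a label of f.  A linear extension of P
-- labelled 1, …, n uses exactly the labels [1, n], a proper initial segment of ℤ/q when n < q, and
-- no nonzero rotation of ℤ/q fixes such a segment; so Pro^N fixing it forces q ∣ N.

open import Defs hiding (_≼_; _≤?_; _≺_; _≺?_; _⋖_; _⋖?_)
open import Data.Bool using (Bool; false; if_then_else_; T; _∧_)
open import Data.Fin using (Fin; toℕ; fromℕ<; punchOut; combine; funToFin; finToFun)
open import Data.Fin.Properties
  using (any?; all?; pigeonhole; injective⇒≤; punchOut-injective; toℕ-injective; toℕ-fromℕ<; toℕ<n;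
         combine-injectiveʳ; combine-monoˡ-<; finToFun-funToFin)
open import Data.Fin.Subset using (Subset; inside; outside; _∈_; ∣_∣)
open import Data.Fin.Subset.Properties using (p⊂q⇒∣p∣<∣q∣; ∣⊤∣≡n; ∈⊤)
open import Data.Maybe using (just; nothing; maybe)
open import Data.Nat
  using (ℕ; zero; suc; _+_; _*_; _^_; _!; _∸_; _<_; _≤_; _≟_; _<?_; _≤?_; _≡ᵇ_; z≤n; s≤s; s≤s⁻¹;
         NonZero)
open import Data.Nat.Properties
open import Data.Nat.DivMod
  using (_%_; m<n⇒m%n≡m; [m+n]%n≡m%n; n%n≡0; m%n<n; m%n%n≡m%n; %-distribˡ-+)
open import Data.Nat.Divisibility using (_∣_; divides; m%n≡0⇒n∣m; ∣-trans; m∣m*n; m≤n⇒m!∣n!)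
open import Data.Nat.Induction using (<-rec)
open import Data.Product using (Σ; ∃; _×_; _,_; proj₁; proj₂)
open import Data.Product.Function.Dependent.Propositional using (congˡ)
open import Data.Product.Function.NonDependent.Propositional using (_×-⇔_)
open import Data.Sum using (_⊎_; inj₁; inj₂)
open import Data.Vec using (tabulate)
open import Data.Vec.Properties using (lookup⇒[]=; []=⇒lookup; lookup∘tabulate)
open import Function using (_∘_; _⇔_; mk⇔; Equivalence)
open import Function.Construct.Composition using (_⇔-∘_)
open import Function.Construct.Identity using (⇔-id)
open import Function.Construct.Symmetry using (⇔-sym)
open import Function.Definitions using (Injective; Congruent)
open import Level using (Level; 0ℓ)
open import Relation.Binary.Bundles using (Setoid)
import Relation.Binary.Construct.NonStrictToStrict as Strict
import Relation.Binary.Construct.On as On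
open import Relation.Binary.Definitions using (tri<; tri≈; tri>)
open import Relation.Binary.PropositionalEquality
  using (_≡_; _≢_; refl; sym; trans; cong; cong₂; cong-app; subst; subst₂; _≗_; ≢-sym; _→-setoid_;
         module ≡-Reasoning)
import Relation.Binary.Reasoning.Setoid as SetoidReasoning
open import Relation.Binary.Structures using (IsDecPartialOrder)
open import Relation.Nullary using (¬_; Dec; yes; no; does; contradiction)
open import Relation.Nullary.Decidable using (_×-dec_; _→-dec_; map′; T?; dec-true; dec-false; does-⇔)
open import Relation.Unary using (Pred; Decidable)

open Equivalence using (to; from)

_∈-image_ : {A : Set} → ℕ → (A → ℕ) → Set
v ∈-image h = ∃ λ x → h x ≡ v

∈-image-≗ : {A : Set} {f g : A → ℕ} {v : ℕ} → f ≗ g → v ∈-image f ⇔ v ∈-image g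
∈-image-≗ f≗g = mk⇔ (λ (x , fx≡v) → x , trans (sym (f≗g x)) fx≡v)
                    (λ (x , gx≡v) → x , trans (f≗g x) gx≡v)

iterate-+ : {A : Set} (F : A → A) (m n : ℕ) (a : A) → iterate F (m + n) a ≡ iterate F m (iterate F n a)
iterate-+ F zero    n a = refl
iterate-+ F (suc m) n a = cong F (iterate-+ F m n a)

module _ {n : ℕ} {p : Level} {Q : Pred (Fin n) p} (Q? : Decidable Q) where

  satisfying : Subset n
  satisfying = tabulate (λ x → if does (Q? x) then inside else outside)

  ∈-satisfying⁺ : ∀ {x} → Q x → x ∈ satisfying
  ∈-satisfying⁺ {x} qx = lookup⇒[]= x satisfying
    (trans (lookup∘tabulate _ x) (cong (if_then inside else outside) (dec-true (Q? x) qx)))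

  ∈-satisfying⁻ : ∀ {x} → x ∈ satisfying → Q x
  ∈-satisfying⁻ {x} x∈ with Q? x | trans (sym (lookup∘tabulate _ x)) ([]=⇒lookup x∈)
  ... | yes qx | _ = qx
  ... | no _   | ()

  count : ℕ
  count = ∣ satisfying ∣

  count<n : ∀ {y} → ¬ Q y → count < n
  count<n {y} ¬qy =
    subst (count <_) (∣⊤∣≡n n) (p⊂q⇒∣p∣<∣q∣ ((λ _ → ∈⊤) , y , ∈⊤ , ¬qy ∘ ∈-satisfying⁻))

count-< : ∀ {n p r} {Q : Pred (Fin n) p} {R : Pred (Fin n) r} (Q? : Decidable Q) (R? : Decidable R) →
          (∀ {x} → Q x → R x) → ∀ {y} → R y → ¬ Q y → count Q? < count R?
count-< Q? R? Q⊆R {y} ry ¬qy = p⊂q⇒∣p∣<∣q∣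
  ((∈-satisfying⁺ R? ∘ Q⊆R ∘ ∈-satisfying⁻ Q?) , y , ∈-satisfying⁺ R? ry , ¬qy ∘ ∈-satisfying⁻ Q?)

injective∧bounded⇒surjective : ∀ {n} (r : Fin n → ℕ) → (∀ x → r x < n) → Injective _≡_ _≡_ r →
                               ∀ {j} → j < n → ∃ λ x → r x ≡ j
injective∧bounded⇒surjective {suc n} r r<n r-injective {j} j<n with any? (λ x → r x ≟ j)
... | yes hit  = hit
... | no  miss = contradiction (injective⇒≤ squeeze-injective) 1+n≰n
  where
  j≢r : ∀ x → fromℕ< j<n ≢ fromℕ< (r<n x)
  j≢r x eq = miss (x , (begin
    r x                    ≡⟨ toℕ-fromℕ< (r<n x) ⟨
    toℕ (fromℕ< (r<n x))   ≡⟨ cong toℕ eq ⟨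
    toℕ (fromℕ< j<n)       ≡⟨ toℕ-fromℕ< j<n ⟩
    j                      ∎))
    where open ≡-Reasoning

  squeeze : Fin (suc n) → Fin n
  squeeze x = punchOut (j≢r x)

  squeeze-injective : Injective _≡_ _≡_ squeeze
  squeeze-injective {x} {y} eq = r-injective (begin
    r x                    ≡⟨ toℕ-fromℕ< (r<n x) ⟨
    toℕ (fromℕ< (r<n x))   ≡⟨ cong toℕ (punchOut-injective (j≢r x) (j≢r y) eq) ⟩
    toℕ (fromℕ< (r<n y))   ≡⟨ toℕ-fromℕ< (r<n y) ⟩
    r y                    ∎)
    where open ≡-Reasoning

module Ranking {n : ℕ} (key : Fin n → ℕ) (key-injective : Injective _≡_ _≡_ key) where

  rank : Fin n → ℕ
  rank x = count (λ w → key w <? key x)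

  rank-mono : ∀ {x y} → key x < key y → rank x < rank y
  rank-mono {x} {y} kx<ky = count-< (λ w → key w <? key x) (λ w → key w <? key y)
    (λ kw<kx → <-trans kw<kx kx<ky) kx<ky (<-irrefl refl)

  rank<n : ∀ x → rank x < n
  rank<n x = count<n (λ w → key w <? key x) (<-irrefl refl)

  rank-injective : Injective _≡_ _≡_ rank
  rank-injective {x} {y} rx≡ry with <-cmp (key x) (key y)
  ... | tri< kx<ky _ _ = contradiction rx≡ry (<⇒≢ (rank-mono kx<ky))
  ... | tri≈ _ kx≡ky _ = key-injective kx≡ky
  ... | tri> _ _ ky<kx = contradiction (sym rx≡ry) (<⇒≢ (rank-mono ky<kx))

  rank-surjective : ∀ {j} → j < n → ∃ λ x → rank x ≡ j
  rank-surjective = injective∧bounded⇒surjective rank rank<n rank-injective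

module FiniteOrder {ℓ} (S : Setoid 0ℓ ℓ) (F : Setoid.Carrier S → Setoid.Carrier S) where

  open Setoid S using (Carrier; _≈_) renaming (refl to ≈-refl)
  open SetoidReasoning S

  iterate-cong : Congruent _≈_ _≈_ F → ∀ N → Congruent _≈_ _≈_ (iterate F N)
  iterate-cong F-cong zero    a≈b = a≈b
  iterate-cong F-cong (suc N) a≈b = F-cong (iterate-cong F-cong N a≈b)

  iterate-injective : Injective _≈_ _≈_ F → ∀ N → Injective _≈_ _≈_ (iterate F N)
  iterate-injective F-injective zero    eq = eq
  iterate-injective F-injective (suc N) eq = iterate-injective F-injective N (F-injective eq)

  iterate-multiple : Congruent _≈_ _≈_ F →
                     ∀ {p a} → iterate F p a ≈ a → ∀ c → iterate F (c * p) a ≈ a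
  iterate-multiple F-cong         returns zero    = ≈-refl
  iterate-multiple F-cong {p} {a} returns (suc c) = begin
    iterate F (p + c * p) a             ≡⟨ iterate-+ F p (c * p) a ⟩
    iterate F p (iterate F (c * p) a)   ≈⟨ iterate-cong F-cong p (iterate-multiple F-cong returns c) ⟩
    iterate F p a                       ≈⟨ returns ⟩
    a                                   ∎

  period : Injective _≈_ _≈_ F → ∀ {L} {code : Carrier → Fin L} → Injective _≈_ _≡_ code →
           ∀ a → ∃ λ p → 1 ≤ p × p ≤ L × iterate F p a ≈ a
  period F-injective {L} {code} code-injective a
    with i , j , i<j , same ← pigeonhole (n<1+n L) (λ i → code (iterate F (toℕ i) a)) =
    toℕ j ∸ toℕ i , m<n⇒0<n∸m i<j , ≤-trans (m∸n≤m (toℕ j) (toℕ i)) (s≤s⁻¹ (toℕ<n j)) ,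
    iterate-injective F-injective (toℕ i) (begin
      iterate F (toℕ i) (iterate F (toℕ j ∸ toℕ i) a)  ≡⟨ iterate-+ F (toℕ i) _ a ⟨
      iterate F (toℕ i + (toℕ j ∸ toℕ i)) a             ≡⟨ cong (λ m → iterate F m a) (m+[n∸m]≡n (<⇒≤ i<j)) ⟩
      iterate F (toℕ j) a                               ≈⟨ code-injective same ⟨
      iterate F (toℕ i) a                               ∎)

  iterate-factorial : Congruent _≈_ _≈_ F → Injective _≈_ _≈_ F →
                      ∀ {L} {code : Carrier → Fin L} → Injective _≈_ _≡_ code →
                      ∀ a → iterate F (L !) a ≈ a
  iterate-factorial F-cong F-injective {L} code-injective a
    with suc p , _ , p≤L , returns ← period F-injective code-injective a
    with divides c L!≡c*[1+p] ← ∣-trans (m∣m*n {suc p} (p !)) (m≤n⇒m!∣n! p≤L) =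
    subst (λ N → iterate F N a ≈ a) (sym L!≡c*[1+p]) (iterate-multiple F-cong returns c)

Minimal : (ℕ → Set) → ℕ → Set
Minimal Q m = Q m × (∀ {k} → k < m → ¬ Q k)

minimal : {Q : ℕ → Set} → (∀ n → Dec (Q n)) → ∀ n → Q n → ∃ (Minimal Q)
minimal {Q} Q? = <-rec (λ n → Q n → ∃ (Minimal Q)) search
  where
  search : ∀ n → (∀ {m} → m < n → Q m → ∃ (Minimal Q)) → Q n → ∃ (Minimal Q)
  search n smaller qn with anyUpTo? Q? n
  ... | yes (m , m<n , qm) = smaller m<n qm
  ... | no  none           = n , qn , λ k<n qk → none (_ , k<n , qk)

[m%n+k]%n≡[m+k]%n : ∀ m k n .{{_ : NonZero n}} → (m % n + k) % n ≡ (m + k) % n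
[m%n+k]%n≡[m+k]%n m k n = begin
  (m % n + k) % n          ≡⟨ %-distribˡ-+ (m % n) k n ⟩
  (m % n % n + k % n) % n  ≡⟨ cong (λ r → (r + k % n) % n) (m%n%n≡m%n m n) ⟩
  (m % n + k % n) % n      ≡⟨ %-distribˡ-+ m k n ⟨
  (m + k) % n              ∎
  where open ≡-Reasoning

segment-invariant⇒∣ : ∀ {m k N} → 0 < m → m < suc k →
                      (∀ {w} → w < suc k → (w < m ⇔ (w + N) % suc k < m)) → suc k ∣ N
segment-invariant⇒∣ {m} {k} {N} 0<m m<q invariant with N % suc k in N%q
... | zero  = m%n≡0⇒n∣m N (suc k) N%q
... | suc r = contradiction (from (invariant (n<1+n k)) (subst (_< m) (sym wrap) r<m)) (<⇒≱ m<q)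
  where
  open ≡-Reasoning
  1+r<m : suc r < m
  1+r<m = subst (_< m) N%q (to (invariant (s≤s z≤n)) 0<m)

  r<m : r < m
  r<m = <-trans (n<1+n r) 1+r<m

  wrap : (k + N) % suc k ≡ r
  wrap = begin
    (k + N) % suc k           ≡⟨ cong (_% suc k) (+-comm k N) ⟩
    (N + k) % suc k           ≡⟨ [m%n+k]%n≡[m+k]%n N k (suc k) ⟨
    (N % suc k + k) % suc k   ≡⟨ cong (λ x → (x + k) % suc k) N%q ⟩
    (suc r + k) % suc k       ≡⟨ cong (_% suc k) (+-suc r k) ⟨
    (r + suc k) % suc k       ≡⟨ [m+n]%n≡m%n r (suc k) ⟩
    r % suc k                 ≡⟨ m<n⇒m%n≡m (<-trans r<m m<q) ⟩
    r                         ∎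

toggleValue : (a v : ℕ) (blockedUp blockedDown : Bool) → ℕ
toggleValue a v up down with v ≟ a | v ≟ suc a
... | yes _ | _     = if up then a else suc a
... | no _  | yes _ = if down then suc a else a
... | no _  | no _  = v

toggleValue-lower : ∀ {a v} up down → v ≡ a → toggleValue a v up down ≡ (if up then a else suc a)
toggleValue-lower {a} up down refl with a ≟ a
... | yes _  = refl
... | no a≢a = contradiction refl a≢a

toggleValue-upper : ∀ {a v} up down → v ≡ suc a →
                    toggleValue a v up down ≡ (if down then suc a else a)
toggleValue-upper {a} up down refl with suc a ≟ a | suc a ≟ suc a
... | yes 1+a≡a | _      = contradiction 1+a≡a 1+n≢n
... | no _      | yes _  = refl
... | no _      | no ¬eq = contradiction refl ¬eq

toggleValue-other : ∀ {a v} up down → v ≢ a → v ≢ suc a → toggleValue a v up down ≡ v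
toggleValue-other {a} {v} up down v≢a v≢1+a with v ≟ a | v ≟ suc a
... | yes v≡a | _         = contradiction v≡a v≢a
... | no _    | yes v≡1+a = contradiction v≡1+a v≢1+a
... | no _    | no _      = refl

toggleValue-cong : ∀ {a v v′ up up′ down down′} → v ≡ v′ → up ≡ up′ → down ≡ down′ →
                   toggleValue a v up down ≡ toggleValue a v′ up′ down′
toggleValue-cong refl refl refl = refl

transpose : ℕ → ℕ → ℕ
transpose a v = toggleValue a v false false

transpose-lower : ∀ a → transpose a a ≡ suc a
transpose-lower a = toggleValue-lower false false refl

transpose-upper : ∀ a → transpose a (suc a) ≡ a
transpose-upper a = toggleValue-upper false false refl

transpose-other : ∀ {a v} → v ≢ a → v ≢ suc a → transpose a v ≡ v
transpose-other = toggleValue-other false false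

transpose-involutive : ∀ a v → transpose a (transpose a v) ≡ v
transpose-involutive a v = by-cases (v ≟ a) (v ≟ suc a)
  where
  by-cases : Dec (v ≡ a) → Dec (v ≡ suc a) → transpose a (transpose a v) ≡ v
  by-cases (yes refl) _          = trans (cong (transpose a) (transpose-lower a)) (transpose-upper a)
  by-cases (no _)     (yes refl) = trans (cong (transpose a) (transpose-upper a)) (transpose-lower a)
  by-cases (no v≢a)   (no v≢1+a) = trans (cong (transpose a) fixed) fixed
    where
    fixed : transpose a v ≡ v
    fixed = transpose-other v≢a v≢1+a

cycle : ℕ → ℕ → ℕ
cycle zero    v = v
cycle (suc k) v = cycle k (transpose (suc k) v)

cycle-fixes : ∀ k {v} → suc k < v → cycle k v ≡ v
cycle-fixes zero    _      = refl
cycle-fixes (suc k) 2+k<v = trans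
  (cong (cycle k) (transpose-other (≢-sym (<⇒≢ 1+k<v)) (≢-sym (<⇒≢ 2+k<v))))
  (cycle-fixes k 1+k<v)
  where
  1+k<v = <-trans (n<1+n (suc k)) 2+k<v

cycle-top : ∀ k → cycle k (suc k) ≡ 1
cycle-top zero    = refl
cycle-top (suc k) = trans (cong (cycle k) (transpose-upper (suc k))) (cycle-top k)

cycle-step : ∀ k {v} → 1 ≤ v → v ≤ k → cycle k v ≡ suc v
cycle-step zero    (s≤s _) ()
cycle-step (suc k) {v} 1≤v v≤1+k with m≤n⇒m<n∨m≡n v≤1+k
... | inj₁ v<1+k = trans
        (cong (cycle k) (transpose-other (<⇒≢ v<1+k) (<⇒≢ (m<n⇒m<1+n v<1+k))))
        (cycle-step k 1≤v (s≤s⁻¹ v<1+k))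
... | inj₂ refl  = trans (cong (cycle k) (transpose-lower (suc k))) (cycle-fixes k (n<1+n (suc k)))

cycle-mod : ∀ k {w} → w ≤ k → cycle k (suc w) ≡ suc (suc w % suc k)
cycle-mod k {w} w≤k with m≤n⇒m<n∨m≡n w≤k
... | inj₁ w<k  = trans (cycle-step k (s≤s z≤n) w<k) (cong suc (sym (m<n⇒m%n≡m (s≤s w<k))))
... | inj₂ refl = trans (cycle-top k) (cong suc (sym (n%n≡0 (suc k))))

module Toggles (P : FinPoset) where

  open FinPoset P using (_≺_; _⋖_; _⋖?_)

  Point : Set
  Point = Fin (n P)

  Increasing : Labeling P → Set
  Increasing h = ∀ x y → x ≺ y → h x < h y

  UpperCoverLabelled LowerCoverLabelled : ℕ → Labeling P → Point → Set
  UpperCoverLabelled v h z = ∃ λ y → z ⋖ y × h y ≡ v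
  LowerCoverLabelled v h z = ∃ λ y → y ⋖ z × h y ≡ v

  upperCoverLabelled? : ∀ v h z → Dec (UpperCoverLabelled v h z)
  upperCoverLabelled? v h z = any? (λ y → z ⋖? y ×-dec h y ≟ v)

  lowerCoverLabelled? : ∀ v h z → Dec (LowerCoverLabelled v h z)
  lowerCoverLabelled? v h z = any? (λ y → y ⋖? z ×-dec h y ≟ v)

  toggle : ℕ → Labeling P → Labeling P
  toggle a h z = toggleValue a (h z) (does (upperCoverLabelled? (suc a) h z)) (does (lowerCoverLabelled? a h z))

  module _ {a : ℕ} (h : Labeling P) (z : Point) where

    toggle-blockedUp : h z ≡ a → UpperCoverLabelled (suc a) h z → toggle a h z ≡ a
    toggle-blockedUp hz≡a up = trans (toggleValue-lower _ _ hz≡a)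
      (cong (if_then a else suc a) (dec-true (upperCoverLabelled? (suc a) h z) up))

    toggle-raised : h z ≡ a → ¬ UpperCoverLabelled (suc a) h z → toggle a h z ≡ suc a
    toggle-raised hz≡a ¬up = trans (toggleValue-lower _ _ hz≡a)
      (cong (if_then a else suc a) (dec-false (upperCoverLabelled? (suc a) h z) ¬up))

    toggle-blockedDown : h z ≡ suc a → LowerCoverLabelled a h z → toggle a h z ≡ suc a
    toggle-blockedDown hz≡1+a down = trans (toggleValue-upper _ _ hz≡1+a)
      (cong (if_then suc a else a) (dec-true (lowerCoverLabelled? a h z) down))

    toggle-lowered : h z ≡ suc a → ¬ LowerCoverLabelled a h z → toggle a h z ≡ a
    toggle-lowered hz≡1+a ¬down = trans (toggleValue-upper _ _ hz≡1+a)
      (cong (if_then suc a else a) (dec-false (lowerCoverLabelled? a h z) ¬down))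

    toggle-untouched : h z ≢ a → h z ≢ suc a → toggle a h z ≡ h z
    toggle-untouched = toggleValue-other _ _

    toggle-fixes-below : h z < a → toggle a h z ≡ h z
    toggle-fixes-below hz<a = toggle-untouched (<⇒≢ hz<a) (<⇒≢ (m<n⇒m<1+n hz<a))

    toggle-fixes-above : suc a < h z → toggle a h z ≡ h z
    toggle-fixes-above 1+a<hz =
      toggle-untouched (≢-sym (<⇒≢ (<-trans (n<1+n a) 1+a<hz))) (≢-sym (<⇒≢ 1+a<hz))

  data ToggleView (a : ℕ) (h : Labeling P) (z : Point) : Set where
    blockedUp   : h z ≡ a → UpperCoverLabelled (suc a) h z → toggle a h z ≡ a → ToggleView a h z
    raised      : h z ≡ a → ¬ UpperCoverLabelled (suc a) h z → toggle a h z ≡ suc a → ToggleView a h z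
    blockedDown : h z ≡ suc a → LowerCoverLabelled a h z → toggle a h z ≡ suc a → ToggleView a h z
    lowered     : h z ≡ suc a → ¬ LowerCoverLabelled a h z → toggle a h z ≡ a → ToggleView a h z
    untouched   : h z ≢ a → h z ≢ suc a → toggle a h z ≡ h z → ToggleView a h z

  toggle-view : ∀ a h z → ToggleView a h z
  toggle-view a h z with h z ≟ a | h z ≟ suc a | upperCoverLabelled? (suc a) h z | lowerCoverLabelled? a h z
  ... | yes e | _     | yes up | _       = blockedUp e up (toggle-blockedUp h z e up)
  ... | yes e | _     | no ¬up | _       = raised e ¬up (toggle-raised h z e ¬up)
  ... | no _  | yes e | _      | yes dn  = blockedDown e dn (toggle-blockedDown h z e dn)
  ... | no _  | yes e | _      | no ¬dn  = lowered e ¬dn (toggle-lowered h z e ¬dn)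
  ... | no ne | no ne′ | _     | _       = untouched ne ne′ (toggle-untouched h z ne ne′)

  data Movement (a : ℕ) (h : Labeling P) (z : Point) : Set where
    stays : toggle a h z ≡ h z → Movement a h z
    rises : h z ≡ a     → ¬ UpperCoverLabelled (suc a) h z → toggle a h z ≡ suc a → Movement a h z
    falls : h z ≡ suc a → ¬ LowerCoverLabelled a h z       → toggle a h z ≡ a     → Movement a h z

  movement : ∀ a h z → Movement a h z
  movement a h z with toggle-view a h z
  ... | blockedUp e _ t   = stays (trans t (sym e))
  ... | raised e ¬up t    = rises e ¬up t
  ... | blockedDown e _ t = stays (trans t (sym e))
  ... | lowered e ¬dn t   = falls e ¬dn t
  ... | untouched _ _ t   = stays t

  consecutive⇒⋖ : ∀ {a h x y} → Increasing h → x ≺ y → h x ≡ a → h y ≡ suc a → x ⋖ y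
  consecutive⇒⋖ {h = h} inc x≺y hx≡a hy≡1+a = x≺y , λ (w , x≺w , w≺y) →
    <⇒≱ (subst (_< h w) hx≡a (inc _ _ x≺w)) (s≤s⁻¹ (subst (h w <_) hy≡1+a (inc _ _ w≺y)))

  toggle-increasing : ∀ a h → Increasing h → Increasing (toggle a h)
  toggle-increasing a h inc x y x≺y = by-movement (movement a h x) (movement a h y)
    where
    hx<hy : h x < h y
    hx<hy = inc x y x≺y

    by-movement : Movement a h x → Movement a h y → toggle a h x < toggle a h y
    by-movement (stays tx) (stays ty) = subst₂ _<_ (sym tx) (sym ty) hx<hy
    by-movement (stays tx) (rises hy≡a _ ty) =
      subst₂ _<_ (sym tx) (sym ty) (m<n⇒m<1+n (subst (h x <_) hy≡a hx<hy))
    by-movement (stays tx) (falls hy≡1+a ¬down ty) = subst₂ _<_ (sym tx) (sym ty)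
      (≤∧≢⇒< (s≤s⁻¹ (subst (h x <_) hy≡1+a hx<hy))
             (λ hx≡a → ¬down (x , consecutive⇒⋖ inc x≺y hx≡a hy≡1+a , hx≡a)))
    by-movement (rises hx≡a ¬up tx) (stays ty) = subst₂ _<_ (sym tx) (sym ty)
      (≤∧≢⇒< (subst (_< h y) hx≡a hx<hy)
             (λ 1+a≡hy → ¬up (y , consecutive⇒⋖ inc x≺y hx≡a (sym 1+a≡hy) , sym 1+a≡hy)))
    by-movement (rises hx≡a _ _) (rises hy≡a _ _) =
      contradiction (trans hx≡a (sym hy≡a)) (<⇒≢ hx<hy)
    by-movement (rises hx≡a ¬up _) (falls hy≡1+a _ _) =
      contradiction (y , consecutive⇒⋖ inc x≺y hx≡a hy≡1+a , hy≡1+a) ¬up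
    by-movement (falls hx≡1+a _ tx) (stays ty) =
      subst₂ _<_ (sym tx) (sym ty) (<-trans (n<1+n a) (subst (_< h y) hx≡1+a hx<hy))
    by-movement (falls hx≡1+a _ _) (rises hy≡a _ _) =
      contradiction hx<hy (<-asym (subst₂ _<_ (sym hy≡a) (sym hx≡1+a) (n<1+n a)))
    by-movement (falls hx≡1+a _ _) (falls hy≡1+a _ _) =
      contradiction (trans hx≡1+a (sym hy≡1+a)) (<⇒≢ hx<hy)

  toggle-involutive : ∀ a h → Increasing h → toggle a (toggle a h) ≗ h
  toggle-involutive a h inc z with toggle-view a h z
  ... | blockedUp hz≡a (y , z⋖y , hy≡1+a) t = trans
        (toggle-blockedUp (toggle a h) z t (y , z⋖y , toggle-blockedDown h y hy≡1+a (z , z⋖y , hz≡a)))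
        (sym hz≡a)
  ... | raised hz≡a _ t = trans (toggle-lowered (toggle a h) z t noLowerCover) (sym hz≡a)
    where
    noLowerCover : ¬ LowerCoverLabelled a (toggle a h) z
    noLowerCover (w , w⋖z , tw≡a) = <⇒≢ hw<a (trans (sym (toggle-fixes-below h w hw<a)) tw≡a)
      where
      hw<a : h w < a
      hw<a = subst (h w <_) hz≡a (inc w z (proj₁ w⋖z))
  ... | blockedDown hz≡1+a (w , w⋖z , hw≡a) t = trans
        (toggle-blockedDown (toggle a h) z t (w , w⋖z , toggle-blockedUp h w hw≡a (z , w⋖z , hz≡1+a)))
        (sym hz≡1+a)
  ... | lowered hz≡1+a _ t = trans (toggle-raised (toggle a h) z t noUpperCover) (sym hz≡1+a)
    where
    noUpperCover : ¬ UpperCoverLabelled (suc a) (toggle a h) z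
    noUpperCover (y , z⋖y , ty≡1+a) = <⇒≢ 1+a<hy (trans (sym ty≡1+a) (toggle-fixes-above h y 1+a<hy))
      where
      1+a<hy : suc a < h y
      1+a<hy = subst (_< h y) hz≡1+a (inc z y (proj₁ z⋖y))
  ... | untouched hz≢a hz≢1+a t =
        trans (toggle-untouched (toggle a h) z (hz≢a ∘ trans (sym t)) (hz≢1+a ∘ trans (sym t))) t

  toggle-cong : ∀ a {f g} → f ≗ g → toggle a f ≗ toggle a g
  toggle-cong a {f} {g} f≗g z = toggleValue-cong (f≗g z)
    (does-⇔ (relabel (suc a)) (upperCoverLabelled? (suc a) f z) (upperCoverLabelled? (suc a) g z))
    (does-⇔ (relabel a) (lowerCoverLabelled? a f z) (lowerCoverLabelled? a g z))
    where
    relabel : ∀ {A : Point → Set} v → (∃ λ y → A y × f y ≡ v) ⇔ (∃ λ y → A y × g y ≡ v)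
    relabel v = congˡ (⇔-id _ ×-⇔ mk⇔ (trans (sym (f≗g _))) (trans (f≗g _)))

  toggle-injective : ∀ a {f g} → Increasing f → Increasing g → toggle a f ≗ toggle a g → f ≗ g
  toggle-injective a {f} {g} incf incg tf≗tg z = begin
    f z                       ≡⟨ toggle-involutive a f incf z ⟨
    toggle a (toggle a f) z   ≡⟨ toggle-cong a tf≗tg z ⟩
    toggle a (toggle a g) z   ≡⟨ toggle-involutive a g incg z ⟩
    g z                       ∎
    where open ≡-Reasoning

  InRange : ℕ → Labeling P → Set
  InRange q h = ∀ z → 1 ≤ h z × h z ≤ q

  toggle-inRange : ∀ {q a h} → 1 ≤ a → a < q → InRange q h → InRange q (toggle a h)
  toggle-inRange {q} {a} {h} 1≤a a<q range z with movement a h z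
  ... | stays t     = subst (λ v → 1 ≤ v × v ≤ q) (sym t) (range z)
  ... | rises _ _ t = subst (λ v → 1 ≤ v × v ≤ q) (sym t) (s≤s z≤n , a<q)
  ... | falls _ _ t = subst (λ v → 1 ≤ v × v ≤ q) (sym t) (1≤a , <⇒≤ a<q)

  image-toggle⁺ : ∀ {a h v} → v ∈-image toggle a h → transpose a v ∈-image h
  image-toggle⁺ {a} {h} (x , refl) with toggle-view a h x
  ... | blockedUp _ (y , _ , hy≡1+a) t =
        subst (λ u → transpose a u ∈-image h) (sym t) (y , trans hy≡1+a (sym (transpose-lower a)))
  ... | raised hx≡a _ t =
        subst (λ u → transpose a u ∈-image h) (sym t) (x , trans hx≡a (sym (transpose-upper a)))
  ... | blockedDown _ (w , _ , hw≡a) t =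
        subst (λ u → transpose a u ∈-image h) (sym t) (w , trans hw≡a (sym (transpose-upper a)))
  ... | lowered hx≡1+a _ t =
        subst (λ u → transpose a u ∈-image h) (sym t) (x , trans hx≡1+a (sym (transpose-lower a)))
  ... | untouched hx≢a hx≢1+a t =
        subst (λ u → transpose a u ∈-image h) (sym t) (x , sym (transpose-other hx≢a hx≢1+a))

  image-toggle : ∀ a {h} v → Increasing h → v ∈-image toggle a h ⇔ transpose a v ∈-image h
  image-toggle a {h} v inc = mk⇔ image-toggle⁺ λ tv∈h →
    subst (_∈-image toggle a h) (transpose-involutive a v)
      (image-toggle⁺ (to (∈-image-≗ (sym ∘ toggle-involutive a h inc)) tv∈h))

  toggles : ℕ → Labeling P → Labeling P
  toggles zero    h = h
  toggles (suc k) h = toggle (suc k) (toggles k h)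

  toggles-cong : ∀ k {f g} → f ≗ g → toggles k f ≗ toggles k g
  toggles-cong zero    f≗g = f≗g
  toggles-cong (suc k) f≗g = toggle-cong (suc k) (toggles-cong k f≗g)

  toggles-increasing : ∀ k {h} → Increasing h → Increasing (toggles k h)
  toggles-increasing zero    inc = inc
  toggles-increasing (suc k) inc = toggle-increasing (suc k) _ (toggles-increasing k inc)

  toggles-injective : ∀ k {f g} → Increasing f → Increasing g → toggles k f ≗ toggles k g → f ≗ g
  toggles-injective zero    _    _    eq = eq
  toggles-injective (suc k) incf incg eq = toggles-injective k incf incg
    (toggle-injective (suc k) (toggles-increasing k incf) (toggles-increasing k incg) eq)

  toggles-inRange : ∀ {q} k {h} → k < q → InRange q h → InRange q (toggles k h)
  toggles-inRange zero    _   range = range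
  toggles-inRange (suc k) k<q range =
    toggle-inRange (s≤s z≤n) k<q (toggles-inRange k (<-trans (n<1+n k) k<q) range)

  image-toggles : ∀ k {h} v → Increasing h → v ∈-image toggles k h ⇔ cycle k v ∈-image h
  image-toggles zero    v _   = ⇔-id _
  image-toggles (suc k) v inc =
    image-toggles k (transpose (suc k) v) inc ⇔-∘ image-toggle (suc k) v (toggles-increasing k inc)

module Slides (P : FinPoset) where

  open FinPoset P using (_⋖_; _⋖?_)
  open Toggles P

  lower : ℕ → ℕ → ℕ
  lower i l = if does (l ≤? i) then l ∸ 1 else l

  -- After the slides for the labels up to i, a box labeling represents the labeling in which
  -- the labels ≤ i, which have already slid, are decremented and the box reads i.
  normalise : ℕ → BoxLabeling P → Labeling P
  normalise i g z = maybe (lower i) i (g z)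

  lower-≤ : ∀ {i l} → l ≤ i → lower i l ≡ l ∸ 1
  lower-≤ {i} {l} l≤i = cong (if_then l ∸ 1 else l) (dec-true (l ≤? i) l≤i)

  lower-> : ∀ {i l} → i < l → lower i l ≡ l
  lower-> {i} {l} i<l = cong (if_then l ∸ 1 else l) (dec-false (l ≤? i) (<⇒≱ i<l))

  lower-step : ∀ {a l} → l ≢ suc a → lower (suc a) l ≡ lower a l
  lower-step {a} {l} l≢1+a with ≤-<-connex l a
  ... | inj₁ l≤a = trans (lower-≤ (m≤n⇒m≤1+n l≤a)) (sym (lower-≤ l≤a))
  ... | inj₂ a<l = trans (lower-> (≤∧≢⇒< a<l (≢-sym l≢1+a))) (sym (lower-> a<l))

  lower-< : ∀ {a l} → 1 ≤ a → l ≤ a → lower a l < a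
  lower-< {suc a} _ l≤1+a = subst (_< suc a) (sym (lower-≤ l≤1+a)) (s≤s (∸-monoˡ-≤ 1 l≤1+a))

  lower-avoids : ∀ {a l} → 1 ≤ a → l ≢ suc a → lower a l < a ⊎ suc a < lower a l
  lower-avoids {a} {l} 1≤a l≢1+a with ≤-<-connex l a
  ... | inj₁ l≤a = inj₁ (lower-< 1≤a l≤a)
  ... | inj₂ a<l = inj₂ (subst (suc a <_) (sym (lower-> a<l)) (≤∧≢⇒< a<l (≢-sym l≢1+a)))

  lower-bounded : ∀ {q l} → lower q l ≤ q → lower q l ≡ l ∸ 1
  lower-bounded {q} {l} bound with ≤-<-connex l q
  ... | inj₁ l≤q = lower-≤ l≤q
  ... | inj₂ q<l = contradiction (subst (_≤ q) (lower-> q<l) bound) (<⇒≱ q<l)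

  normalise-label : ∀ a g y → T (isLabel (g y) (suc a)) ⇔ normalise a g y ≡ suc a
  normalise-label a g y = by-cases (g y)
    where
    by-cases : ∀ m → T (isLabel m (suc a)) ⇔ maybe (lower a) a m ≡ suc a
    by-cases nothing  = mk⇔ (λ ()) (λ a≡1+a → contradiction (sym a≡1+a) 1+n≢n)
    by-cases (just l) = mk⇔ to-lower from-lower
      where
      to-lower : T (l ≡ᵇ suc a) → lower a l ≡ suc a
      to-lower l≡ᵇ1+a = trans (cong (lower a) (≡ᵇ⇒≡ l (suc a) l≡ᵇ1+a)) (lower-> (n<1+n a))

      from-lower : lower a l ≡ suc a → T (l ≡ᵇ suc a)
      from-lower lower≡1+a with ≤-<-connex l a
      ... | inj₁ l≤a = contradiction (subst (_≤ a) lower≡1+a lower≤a) (<⇒≱ (n<1+n a))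
        where
        lower≤a : lower a l ≤ a
        lower≤a = ≤-trans (≤-reflexive (lower-≤ l≤a)) (≤-trans (m∸n≤m l 1) l≤a)
      ... | inj₂ a<l = ≡⇒≡ᵇ l (suc a) (trans (sym (lower-> a<l)) lower≡1+a)

  normalise-box : ∀ a g x → 1 ≤ a → T (isBox (g x)) ⇔ normalise a g x ≡ a
  normalise-box a g x 1≤a = by-cases (g x)
    where
    by-cases : ∀ m → T (isBox m) ⇔ maybe (lower a) a m ≡ a
    by-cases nothing  = mk⇔ (λ _ → refl) _
    by-cases (just l) = mk⇔ (λ ()) λ lower≡a → contradiction lower≡a (from-lower l)
      where
      from-lower : ∀ l → lower a l ≢ a
      from-lower l with ≤-<-connex l a
      ... | inj₁ l≤a = <⇒≢ (lower-< 1≤a l≤a)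
      ... | inj₂ a<l = ≢-sym (<⇒≢ (subst (a <_) (sym (lower-> a<l)) a<l))

  module _ {i : ℕ} (g : BoxLabeling P) (z : Point) where

    private
      labelAbove? : Dec (∃ λ y → z ⋖ y × T (isLabel (g y) i))
      labelAbove? = any? (λ y → z ⋖? y ×-dec T? (isLabel (g y) i))

      boxBelow? : Dec (∃ λ x → x ⋖ z × T (isBox (g x)))
      boxBelow? = any? (λ x → x ⋖? z ×-dec T? (isBox (g x)))

    slideStep-fills : g z ≡ nothing → (∃ λ y → z ⋖ y × T (isLabel (g y) i)) →
                      slideStep P i g z ≡ just i
    slideStep-fills _ up with g z
    ... | nothing = cong (if_then just i else nothing) (dec-true labelAbove? up)

    slideStep-keepsBox : g z ≡ nothing → ¬ (∃ λ y → z ⋖ y × T (isLabel (g y) i)) →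
                         slideStep P i g z ≡ nothing
    slideStep-keepsBox _ ¬up with g z
    ... | nothing = cong (if_then just i else nothing) (dec-false labelAbove? ¬up)

    slideStep-vacates : g z ≡ just i → (∃ λ x → x ⋖ z × T (isBox (g x))) →
                        slideStep P i g z ≡ nothing
    slideStep-vacates gz≡i down with g z
    ... | just l with refl ← gz≡i =
      cong₂ (λ b c → if b ∧ c then nothing else just i) (dec-true (i ≟ i) refl) (dec-true boxBelow? down)

    slideStep-keepsLabel : g z ≡ just i → ¬ (∃ λ x → x ⋖ z × T (isBox (g x))) →
                           slideStep P i g z ≡ just i
    slideStep-keepsLabel gz≡i ¬down with g z
    ... | just l with refl ← gz≡i =
      cong₂ (λ b c → if b ∧ c then nothing else just i) (dec-true (i ≟ i) refl) (dec-false boxBelow? ¬down)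

    slideStep-ignores : ∀ {l} → g z ≡ just l → l ≢ i → slideStep P i g z ≡ just l
    slideStep-ignores {l} gz≡l l≢i with g z
    ... | just l with refl ← gz≡l =
      cong (λ b → if b ∧ does boxBelow? then nothing else just l) (dec-false (l ≟ i) l≢i)

  slideStep-toggle : ∀ a g → 1 ≤ a →
                     normalise (suc a) (slideStep P (suc a) g) ≗ toggle a (normalise a g)
  slideStep-toggle a g 1≤a z = by-cases (g z) refl
    where
    open ≡-Reasoning
    h = normalise a g
    slid = normalise (suc a) (slideStep P (suc a) g) z

    after : ∀ {m} → slideStep P (suc a) g z ≡ m → slid ≡ maybe (lower (suc a)) (suc a) m
    after = cong (maybe (lower (suc a)) (suc a))

    upper⇔ : (∃ λ y → z ⋖ y × T (isLabel (g y) (suc a))) ⇔ UpperCoverLabelled (suc a) h z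
    upper⇔ = congˡ (⇔-id _ ×-⇔ normalise-label a g _)

    lower⇔ : (∃ λ x → x ⋖ z × T (isBox (g x))) ⇔ LowerCoverLabelled a h z
    lower⇔ = congˡ (⇔-id _ ×-⇔ normalise-box a g _ 1≤a)

    by-cases : ∀ m → g z ≡ m → slid ≡ toggle a h z
    by-cases nothing gz = box (upperCoverLabelled? (suc a) h z)
      where
      hz≡a : h z ≡ a
      hz≡a = cong (maybe (lower a) a) gz

      box : Dec (UpperCoverLabelled (suc a) h z) → slid ≡ toggle a h z
      box (yes up) = begin
        slid                   ≡⟨ after (slideStep-fills g z gz (from upper⇔ up)) ⟩
        lower (suc a) (suc a)  ≡⟨ lower-≤ {suc a} ≤-refl ⟩
        a                      ≡⟨ toggle-blockedUp h z hz≡a up ⟨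
        toggle a h z           ∎
      box (no ¬up) = begin
        slid                   ≡⟨ after (slideStep-keepsBox g z gz (¬up ∘ to upper⇔)) ⟩
        suc a                  ≡⟨ toggle-raised h z hz≡a ¬up ⟨
        toggle a h z           ∎
    by-cases (just l) gz with l ≟ suc a
    ... | yes refl = label (lowerCoverLabelled? a h z)
      where
      hz≡1+a : h z ≡ suc a
      hz≡1+a = trans (cong (maybe (lower a) a) gz) (lower-> (n<1+n a))

      label : Dec (LowerCoverLabelled a h z) → slid ≡ toggle a h z
      label (yes down) = begin
        slid                   ≡⟨ after (slideStep-vacates g z gz (from lower⇔ down)) ⟩
        suc a                  ≡⟨ toggle-blockedDown h z hz≡1+a down ⟨
        toggle a h z           ∎
      label (no ¬down) = begin
        slid                   ≡⟨ after (slideStep-keepsLabel g z gz (¬down ∘ to lower⇔)) ⟩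
        lower (suc a) (suc a)  ≡⟨ lower-≤ {suc a} ≤-refl ⟩
        a                      ≡⟨ toggle-lowered h z hz≡1+a ¬down ⟨
        toggle a h z           ∎
    ... | no l≢1+a = begin
        slid                   ≡⟨ after (slideStep-ignores g z gz l≢1+a) ⟩
        lower (suc a) l        ≡⟨ lower-step l≢1+a ⟩
        lower a l              ≡⟨ hz≡lower ⟨
        h z                    ≡⟨ fixed (lower-avoids 1≤a l≢1+a) ⟨
        toggle a h z           ∎
      where
      hz≡lower : h z ≡ lower a l
      hz≡lower = cong (maybe (lower a) a) gz

      fixed : lower a l < a ⊎ suc a < lower a l → toggle a h z ≡ h z
      fixed (inj₁ <a)   = toggle-fixes-below h z (subst (_< a) (sym hz≡lower) <a)
      fixed (inj₂ 1+a<) = toggle-fixes-above h z (subst (suc a <_) (sym hz≡lower) 1+a<)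

  start : Labeling P → BoxLabeling P
  start f z = if f z ≡ᵇ 1 then nothing else just (f z)

  normalise-start : ∀ f → normalise 1 (start f) ≗ f
  normalise-start f z with f z
  ... | zero        = refl
  ... | suc zero    = refl
  ... | suc (suc _) = refl

  slideUpTo-toggles : ∀ k f → normalise (suc k) (slideUpTo P (suc k) (start f)) ≗ toggles k f
  slideUpTo-toggles zero    f   = normalise-start f
  slideUpTo-toggles (suc k) f z = trans
    (slideStep-toggle (suc k) (slideUpTo P (suc k) (start f)) (s≤s z≤n) z)
    (toggle-cong (suc k) (slideUpTo-toggles k f) z)

  -- Pro decrements every label of the final box labeling, normalise only those ≤ q; they agree
  -- because that box labeling represents toggles k f, whose labels are ≤ q.
  Pro-toggles : ∀ k f → InRange (suc k) f → Pro P (suc k) f ≗ toggles k f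
  Pro-toggles k f range z = trans (decrement (g z) bound) (slideUpTo-toggles k f z)
    where
    g = slideUpTo P (suc k) (start f)

    bound : normalise (suc k) g z ≤ suc k
    bound = subst (_≤ suc k) (sym (slideUpTo-toggles k f z)) (proj₂ (toggles-inRange k (n<1+n k) range z))

    decrement : ∀ m → maybe (lower (suc k)) (suc k) m ≤ suc k →
                maybe (_∸ 1) (suc k) m ≡ maybe (lower (suc k)) (suc k) m
    decrement nothing  _      = refl
    decrement (just l) lower≤ = sym (lower-bounded {suc k} {l} lower≤)

module LinearExtension (P : FinPoset) where

  open FinPoset P using (_≼_; _≺_; _≺?_)
  open IsDecPartialOrder (isDecPartialOrder P) using (isPartialOrder)

  depth : Fin (n P) → ℕ
  depth x = count (_≺? x)

  depth-mono : ∀ {x y} → x ≺ y → depth x < depth y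
  depth-mono {x} {y} x≺y = count-< (_≺? x) (_≺? y)
    (λ w≺x → Strict.<-trans _≡_ _≼_ isPartialOrder w≺x x≺y) x≺y
    (Strict.<-irrefl _≡_ _≼_ refl)

  depth<n : ∀ x → depth x < n P
  depth<n x = count<n (_≺? x) (Strict.<-irrefl _≡_ _≼_ refl)

  -- toℕ (combine d x) = n * toℕ d + toℕ x: points ordered by depth, ties broken by index.
  key : Fin (n P) → ℕ
  key x = toℕ (combine (fromℕ< (depth<n x)) x)

  key-injective : Injective _≡_ _≡_ key
  key-injective {x} {y} eq =
    combine-injectiveʳ (fromℕ< (depth<n x)) x (fromℕ< (depth<n y)) y (toℕ-injective eq)

  key-mono : ∀ {x y} → x ≺ y → key x < key y
  key-mono {x} {y} x≺y = combine-monoˡ-< x y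
    (subst₂ _<_ (sym (toℕ-fromℕ< (depth<n x))) (sym (toℕ-fromℕ< (depth<n y))) (depth-mono x≺y))

  open Ranking key key-injective

  linearExtension : Labeling P
  linearExtension x = suc (rank x)

  linearExtension-inc : ∀ {q} → n P < q → Inc P q linearExtension
  linearExtension-inc n<q =
    (λ x → s≤s z≤n , ≤-trans (rank<n x) (<⇒≤ n<q)) , λ x y x≺y → s≤s (rank-mono (key-mono x≺y))

  image-linearExtension : ∀ {w} → suc w ∈-image linearExtension ⇔ w < n P
  image-linearExtension = mk⇔
    (λ (x , 1+rx≡1+w) → subst (_< n P) (suc-injective 1+rx≡1+w) (rank<n x))
    (λ w<n → let x , rx≡w = rank-surjective w<n in x , cong suc rx≡w)

module Promotion (P : FinPoset) (k : ℕ) where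

  open FinPoset P using (_≺?_)
  open Toggles P
  open Slides P

  q : ℕ
  q = suc k

  Inc-≗ : ∀ {f g} → f ≗ g → Inc P q f → Inc P q g
  Inc-≗ f≗g (range , inc) =
    (λ z → subst (λ v → 1 ≤ v × v ≤ q) (f≗g z) (range z)) ,
    (λ x y x≺y → subst₂ _<_ (f≗g x) (f≗g y) (inc x y x≺y))

  Inc? : ∀ f → Dec (Inc P q f)
  Inc? f = all? (λ x → 1 ≤? f x ×-dec f x ≤? q) ×-dec
           all? (λ x → all? λ y → x ≺? y →-dec f x <? f y)

  Pro-inc : ∀ {f} → Inc P q f → Inc P q (Pro P q f)
  Pro-inc {f} (range , inc) =
    Inc-≗ (sym ∘ Pro-toggles k f range) (toggles-inRange k (n<1+n k) range , toggles-increasing k inc)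

  Pro^-inc : ∀ N {f} → Inc P q f → Inc P q (iterate (Pro P q) N f)
  Pro^-inc zero    incf = incf
  Pro^-inc (suc N) incf = Pro-inc (Pro^-inc N incf)

  Pro-cong : ∀ {f g} → Inc P q f → Inc P q g → f ≗ g → Pro P q f ≗ Pro P q g
  Pro-cong {f} {g} (rangef , _) (rangeg , _) f≗g z = begin
    Pro P q f z    ≡⟨ Pro-toggles k f rangef z ⟩
    toggles k f z  ≡⟨ toggles-cong k f≗g z ⟩
    toggles k g z  ≡⟨ Pro-toggles k g rangeg z ⟨
    Pro P q g z    ∎
    where open ≡-Reasoning

  Pro-injective : ∀ {f g} → Inc P q f → Inc P q g → Pro P q f ≗ Pro P q g → f ≗ g
  Pro-injective {f} {g} (rangef , incf) (rangeg , incg) Pf≗Pg = toggles-injective k incf incg λ z → begin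
    toggles k f z  ≡⟨ Pro-toggles k f rangef z ⟨
    Pro P q f z    ≡⟨ Pf≗Pg z ⟩
    Pro P q g z    ≡⟨ Pro-toggles k g rangeg z ⟩
    toggles k g z  ∎
    where open ≡-Reasoning

  image-Pro : ∀ {f w} → Inc P q f → w < q → suc w ∈-image Pro P q f ⇔ suc (suc w % q) ∈-image f
  image-Pro {f} {w} (range , inc) w<q =
    subst (λ v → suc w ∈-image Pro P q f ⇔ v ∈-image f) (cycle-mod k (s≤s⁻¹ w<q))
      (image-toggles k (suc w) inc ⇔-∘ ∈-image-≗ (Pro-toggles k f range))

  image-Pro^ : ∀ N {f w} → Inc P q f → w < q →
               suc w ∈-image iterate (Pro P q) N f ⇔ suc ((w + N) % q) ∈-image f
  image-Pro^ zero {f} {w} _ w<q =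
    subst (λ v → suc w ∈-image f ⇔ suc v ∈-image f) (sym w+0%q≡w) (⇔-id _)
    where
    w+0%q≡w : (w + 0) % q ≡ w
    w+0%q≡w = trans (cong (_% q) (+-identityʳ w)) (m<n⇒m%n≡m w<q)
  image-Pro^ (suc N) {f} {w} incf w<q =
    subst (λ v → suc w ∈-image iterate (Pro P q) (suc N) f ⇔ suc v ∈-image f) shift
      (image-Pro^ N incf (m%n<n (suc w) q) ⇔-∘ image-Pro (Pro^-inc N incf) w<q)
    where
    shift : (suc w % q + N) % q ≡ (w + suc N) % q
    shift = trans ([m%n+k]%n≡[m+k]%n (suc w) N q) (cong (_% q) (sym (+-suc w N)))

  image-fixed : ∀ N {f} → Inc P q f → iterate (Pro P q) N f ≗ f →
                ∀ {w} → w < q → suc w ∈-image f ⇔ suc ((w + N) % q) ∈-image f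
  image-fixed N incf fixed w<q = image-Pro^ N incf w<q ⇔-∘ ∈-image-≗ (sym ∘ fixed)

  IncLabeling : Set
  IncLabeling = Σ (Labeling P) (Inc P q)

  incSetoid : Setoid 0ℓ 0ℓ
  incSetoid = On.setoid {B = IncLabeling} (Fin (n P) →-setoid ℕ) proj₁

  open Setoid incSetoid using (_≈_)

  promote : IncLabeling → IncLabeling
  promote (f , incf) = Pro P q f , Pro-inc incf

  promote-cong : Congruent _≈_ _≈_ promote
  promote-cong {_ , incf} {_ , incg} = Pro-cong incf incg

  promote-injective : Injective _≈_ _≈_ promote
  promote-injective {_ , incf} {_ , incg} = Pro-injective incf incg

  codes : ℕ
  codes = suc q ^ n P

  encode : IncLabeling → Fin codes
  encode (f , range , _) = funToFin (λ x → fromℕ< (s≤s (proj₂ (range x))))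

  decode : Fin codes → Labeling P
  decode c x = toℕ (finToFun c x)

  decode-encode : ∀ f → decode (encode f) ≗ proj₁ f
  decode-encode (f , range , _) x = trans (cong toℕ (finToFun-funToFin _ x)) (toℕ-fromℕ< _)

  encode-injective : Injective _≈_ _≡_ encode
  encode-injective {f} {g} eq x = begin
    proj₁ f x           ≡⟨ decode-encode f x ⟨
    decode (encode f) x ≡⟨ cong (λ c → decode c x) eq ⟩
    decode (encode g) x ≡⟨ decode-encode g x ⟩
    proj₁ g x           ∎
    where open ≡-Reasoning

  proj₁-iterate : ∀ N f → proj₁ (iterate promote N f) ≡ iterate (Pro P q) N (proj₁ f)
  proj₁-iterate zero    f = refl
  proj₁-iterate (suc N) f = cong (Pro P q) (proj₁-iterate N f)

  -- Equality of IncLabeling ignores the Inc-proof, so the implicit arguments of promote-cong,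
  -- promote-injective and encode-injective cannot be inferred and are passed explicitly.
  open FiniteOrder incSetoid promote

  Pro^-cong : ∀ N {f g} → Inc P q f → Inc P q g → f ≗ g →
              iterate (Pro P q) N f ≗ iterate (Pro P q) N g
  Pro^-cong N {f} {g} incf incg f≗g x = begin
    iterate (Pro P q) N f x                ≡⟨ cong-app (proj₁-iterate N (f , incf)) x ⟨
    proj₁ (iterate promote N (f , incf)) x ≡⟨ iterate-cong (λ {f} {g} → promote-cong {f} {g}) N f≗g x ⟩
    proj₁ (iterate promote N (g , incg)) x ≡⟨ cong-app (proj₁-iterate N (g , incg)) x ⟩
    iterate (Pro P q) N g x                ∎
    where open ≡-Reasoning

  promote-isId⇒ProPowerIsId : ∀ N → (∀ f → iterate promote N f ≈ f) → ProPowerIsId P q N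
  promote-isId⇒ProPowerIsId N returns f incf x =
    trans (sym (cong-app (proj₁-iterate N (f , incf)) x)) (returns (f , incf) x)

  Pro^-factorial-isId : ProPowerIsId P q (codes !)
  Pro^-factorial-isId = promote-isId⇒ProPowerIsId (codes !)
    (iterate-factorial (λ {f} {g} → promote-cong {f} {g}) (λ {f} {g} → promote-injective {f} {g})
                       (λ {f} {g} → encode-injective {f} {g}))

  ProPowerIsId? : ∀ N → Dec (ProPowerIsId P q N)
  ProPowerIsId? N = map′ fromCodes (λ isId c incc → isId (decode c) incc)
    (all? λ c → Inc? (decode c) →-dec all? λ x → iterate (Pro P q) N (decode c) x ≟ decode c x)
    where
    fromCodes : (∀ c → Inc P q (decode c) → ∀ x → iterate (Pro P q) N (decode c) x ≡ decode c x) →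
                ProPowerIsId P q N
    fromCodes onCodes f incf x = begin
      iterate (Pro P q) N f x  ≡⟨ Pro^-cong N incf incg (sym ∘ g≗f) x ⟩
      iterate (Pro P q) N g x  ≡⟨ onCodes (encode (f , incf)) incg x ⟩
      g x                      ≡⟨ g≗f x ⟩
      f x                      ∎
      where
      open ≡-Reasoning
      g = decode (encode (f , incf))
      g≗f = decode-encode (f , incf)
      incg = Inc-≗ (sym ∘ g≗f) incf

  promotionOrder : ∃ (IsPromotionOrder P q)
  promotionOrder
    with N , (1≤N , isId) , smaller ←
           minimal (λ N → 1 ≤? N ×-dec ProPowerIsId? N) (codes !) (1≤n! codes , Pro^-factorial-isId)
    = N , 1≤N , isId , λ M 1≤M M<N isIdM → smaller M<N (1≤M , isIdM)

corollary3p18 : (P : FinPoset) (q : ℕ) → 1 ≤ n P → n P < q →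
    Σ ℕ (λ N → IsPromotionOrder P q N × q ∣ N)
corollary3p18 P zero    _   ()
corollary3p18 P (suc k) 1≤n n<q with N , order@(_ , isId , _) ← Promotion.promotionOrder P k =
  N , order , segment-invariant⇒∣ 1≤n n<q λ w<q →
    image-linearExtension ⇔-∘
      (image-fixed N inc (isId linearExtension inc) w<q ⇔-∘ ⇔-sym image-linearExtension)
  where
  open LinearExtension P
  open Promotion P k
  inc = linearExtension-inc n<q
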